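{- Let $G$ be a filter in the Ignatiev algebra $\mathfrak{I}$ and let $n\in\omega$. Let $H=\Diamond_n^\mathfrak{I}G$ be the $\le_\mathfrak{I}$-upward closed subset of $I$ generated by $\{\Diamond_n^\mathfrak{I}\vec\alpha:\vec\alpha\in G\}$. For each $i$, let $G_i=\{\alpha_i:\vec\alpha\in G\}$ and $H_i=\{\alpha_i:\vec\alpha\in H\}$ be the $i$-th projections. Then: - $H_{n+1}=\{0\}$; and - for all $i\le n$, $H_i=\{\alpha:\exists\gamma\in G_i\,\exists\delta\in H_{i+1}\ \alpha\le\gamma+\omega^\delta\}$, i.e. $H_i$ is the initial segment generated by $\{\gamma+\omega^\delta:\gamma\in G_i,\delta\in H_{i+1}\}$.
   Context: Ordinal conventions: $\varepsilon_0$ is the least ordinal $\varepsilon$ with $\omega^\varepsilon=\varepsilon$. For an ordinal $\alpha>0$, $\ell(\alpha)$ is the unique $\beta$ such that $\alpha=\gamma+\omega^\beta$ for some $\gamma$. Also $\ell(0)=0$. Ignatiev sequences: $I$ is the set of sequences $\vec\alpha=(\alpha_i)_{i\in\omega}$ of ordinals $<\varepsilon_0$ with $\alpha_{i+1}\le\ell(\alpha_i)$ for all $i$. Ignatiev algebra $\mathfrak{I}$: its universe is $I$. The order is $\vec\alpha\le_\mathfrak{I}\vec\beta$ iff $\alpha_i\ge\beta_i$ for all $i$. The meet $\vec\alpha\land_\mathfrak{I}\vec\beta$ is the $\le_\mathfrak{I}$-greatest lower bound. Explicitly, put $\gamma_i=\max(\alpha_i,\beta_i)$ and take $N$ with $\gamma_i=0$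 for $i\ge N$. Then $\vec\delta=\vec\alpha\land_\mathfrak{I}\vec\beta$ has $\delta_i=0$ for $i\ge N$, and downward for $i<N$: $\delta_i=\gamma_i$ if $\ell(\gamma_i)\ge\delta_{i+1}$, and $\delta_i=\gamma_i+\omega^{\delta_{i+1}}$ otherwise. The operator $\Diamond_n^\mathfrak{I}$: $\Diamond_n^\mathfrak{I}\vec\alpha=\vec\beta$ where $\beta_i=0$ for $i>n$, and recursively for $i=n,n-1,\dots,0$, $\beta_i=\alpha_i+\omega^{\beta_{i+1}}$. Filters: a filter in $\mathfrak{I}$ is a nonempty $F\subseteq I$ that is upward closed under $\le_\mathfrak{I}$ and closed under $\land_\mathfrak{I}$. -}

module Defs where

open import Data.Nat using (ℕ; zero; suc; _∸_; _≤ᵇ_)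
open import Data.Bool using (Bool; true; false; if_then_else_)
open import Data.Product using (Σ; ∃; _×_; _,_)
open import Data.Sum using (_⊎_)
open import Data.Unit using (⊤)
open import Relation.Binary.PropositionalEquality using (_≡_)

-- Ordinals below ε₀, in Cantor normal form.  Normal forms (NF) are exactly
-- the terms  ω^a₁ + (ω^a₂ + (… + 0))  with a₁ ≥ a₂ ≥ …, each aᵢ in NF;
-- these are in bijection with the ordinals < ε₀, so ≡ on NF terms is
-- equality of ordinals.

data Tm : Set where
  𝟎    : Tm
  ω^_+_ : Tm → Tm → Tm

infixr 30 ω^_+_

infix 4 _<_ _≤_
data _<_ : Tm → Tm → Set where
  0<ω   : ∀ {a b} → 𝟎 < ω^ a + b
  exp<  : ∀ {a b c d} → a < c → ω^ a + b < ω^ c + d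
  rest< : ∀ {a b d} → b < d → ω^ a + b < ω^ a + d

_≤_ : Tm → Tm → Set
a ≤ b = a < b ⊎ a ≡ b

LeadLe : Tm → Tm → Set
LeadLe 𝟎          a = ⊤
LeadLe (ω^ c + d) a = c ≤ a

data NF : Tm → Set where
  nf0 : NF 𝟎
  nfω : ∀ {a b} → NF a → NF b → LeadLe b a → NF (ω^ a + b)

data Cmp : Set where
  lt eq gt : Cmp

cmp : Tm → Tm → Cmp
cmp 𝟎 𝟎 = eq
cmp 𝟎 (ω^ _ + _) = lt
cmp (ω^ _ + _) 𝟎 = gt
cmp (ω^ a + b) (ω^ c + d) with cmp a c
... | lt = lt
... | gt = gt
... | eq = cmp b d

_<ᵇ_ : Tm → Tm → Bool
a <ᵇ b with cmp a b
... | lt = true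
... | _  = false

infixl 20 _⊕_
_⊕_ : Tm → Tm → Tm
𝟎 ⊕ c = c
(ω^ a + b) ⊕ 𝟎 = ω^ a + b
(ω^ a + b) ⊕ (ω^ e + f) =
  if a <ᵇ e then ω^ e + f else ω^ a + (b ⊕ (ω^ e + f))

ωpow : Tm → Tm
ωpow x = ω^ x + 𝟎

-- ℓ(α): the β with α = γ + ω^β ;  ℓ(0) = 0
ℓ : Tm → Tm
ℓ 𝟎 = 𝟎
ℓ (ω^ a + 𝟎) = a
ℓ (ω^ a + (ω^ c + d)) = ℓ (ω^ c + d)

Seq : Set
Seq = ℕ → Tm

IsIgn : Seq → Set
IsIgn s = ∀ i → NF (s i) × s (suc i) ≤ ℓ (s i)

_≤𝔍_ : Seq → Seq → Set
s ≤𝔍 t = ∀ i → t i ≤ s i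

IsMeet : Seq → Seq → Seq → Set
IsMeet s t u =
  IsIgn u × u ≤𝔍 s × u ≤𝔍 t ×
  (∀ v → IsIgn v → v ≤𝔍 s → v ≤𝔍 t → v ≤𝔍 u)

record IsFilter (F : Seq → Set) : Set where
  field
    sub      : ∀ s → F s → IsIgn s
    nonempty : ∃ F
    upward   : ∀ s t → F s → IsIgn t → s ≤𝔍 t → F t
    meet     : ∀ s t u → F s → F t → IsMeet s t u → F u

-- ◇_n^𝔍 : β_i = 0 for i > n, β_i = α_i + ω^{β_{i+1}} for i ≤ n.
-- dia-aux k i computes β_i when i + k = n.
dia-aux : Seq → ℕ → ℕ → Tm
dia-aux α zero    i = α i ⊕ ωpow 𝟎
dia-aux α (suc k) i = α i ⊕ ωpow (dia-aux α k (suc i))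

◇ : ℕ → Seq → Seq
◇ n α i = if i ≤ᵇ n then dia-aux α (n ∸ i) i else 𝟎

◇Filt : ℕ → (Seq → Set) → Seq → Set
◇Filt n G t = IsIgn t × Σ Seq (λ s → G s × ◇ n s ≤𝔍 t)

Proj : (Seq → Set) → ℕ → Tm → Set
Proj P i α = Σ Seq (λ s → P s × s i ≡ α)

module Submission where

-- Write H = ◇ₙG.  Since ◇ₙs vanishes above n, H_{n+1} = {0}.
-- For i ≤ n we have (◇ₙs)ᵢ = sᵢ + ω^{(◇ₙs)_{i+1}}, so every element of Hᵢ is
-- bounded by some γ + ω^δ with γ ∈ Gᵢ and δ = (◇ₙs)_{i+1} ∈ H_{i+1}.
-- Conversely, let γ = sᵢ (s ∈ G) and δ ≤ (◇ₙs')_{i+1} (s' ∈ G).  The filter G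
-- contains an upper bound u of s and s' on the indices ≤ n (the meet of their
-- truncations at n), so by monotonicity of ◇ₙ and of β ↦ β + ω^δ we get
-- γ + ω^δ ≤ (◇ₙu)ᵢ; finally every projection of an upward closed subset of I
-- is downward closed, since lowering one entry and zeroing the later ones
-- stays inside I.

open import Defs
open import Data.Nat using (ℕ; suc) renaming (_≤_ to _≤ℕ_)
open import Data.Product using (Σ; _×_)
open import Function.Bundles using (_⇔_)
open import Relation.Binary.PropositionalEquality using (_≡_)

open import Data.Nat using (zero; _∸_; _≤ᵇ_; _+_) renaming (_<_ to _<ℕ_)
import Data.Nat.Properties as ℕₚ
open import Data.Bool using (true; false; T; if_then_else_)
open import Data.Product using (_,_; proj₁; proj₂)
open import Data.Sum using (inj₁; inj₂; _⊎_)
open import Data.Unit using (tt)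
open import Data.Empty using (⊥; ⊥-elim)
open import Relation.Nullary using (yes; no)
open import Function.Base using (_∘_)
open import Function.Bundles using (mk⇔)
open import Relation.Binary.PropositionalEquality using (refl; sym; trans; cong; cong₂; subst)

<-irrefl : ∀ {a} → a < a → ⊥
<-irrefl (exp< p)  = <-irrefl p
<-irrefl (rest< p) = <-irrefl p

<-trans : ∀ {a b c} → a < b → b < c → a < c
<-trans 0<ω       (exp< q)  = 0<ω
<-trans 0<ω       (rest< q) = 0<ω
<-trans (exp< p)  (exp< q)  = exp< (<-trans p q)
<-trans (exp< p)  (rest< q) = exp< p
<-trans (rest< p) (exp< q)  = exp< q
<-trans (rest< p) (rest< q) = rest< (<-trans p q)

≤-trans : ∀ {a b c} → a ≤ b → b ≤ c → a ≤ c
≤-trans (inj₁ p)    (inj₁ q)    = inj₁ (<-trans p q)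
≤-trans (inj₁ p)    (inj₂ refl) = inj₁ p
≤-trans (inj₂ refl) q           = q

≤-<-trans : ∀ {a b c} → a ≤ b → b < c → a < c
≤-<-trans (inj₁ p)    q = <-trans p q
≤-<-trans (inj₂ refl) q = q

≤⇒≯ : ∀ {a b} → a ≤ b → b < a → ⊥
≤⇒≯ p q = <-irrefl (≤-<-trans p q)

cons-≤ : ∀ {x b b'} → b ≤ b' → ω^ x + b ≤ ω^ x + b'
cons-≤ (inj₁ p)    = inj₁ (rest< p)
cons-≤ (inj₂ refl) = inj₂ refl

<-or-≥ : ∀ a b → a < b ⊎ b ≤ a
<-or-≥ 𝟎          𝟎          = inj₂ (inj₂ refl)
<-or-≥ 𝟎          (ω^ _ + _) = inj₁ 0<ω
<-or-≥ (ω^ _ + _) 𝟎          = inj₂ (inj₁ 0<ω)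
<-or-≥ (ω^ a + b) (ω^ c + d) with <-or-≥ a c
... | inj₁ p        = inj₁ (exp< p)
... | inj₂ (inj₁ p) = inj₂ (inj₁ (exp< p))
... | inj₂ (inj₂ refl) with <-or-≥ b d
...   | inj₁ p = inj₁ (rest< p)
...   | inj₂ q = inj₂ (cons-≤ q)

0≤ : ∀ a → 𝟎 ≤ a
0≤ 𝟎          = inj₂ refl
0≤ (ω^ _ + _) = inj₁ 0<ω

ωpow-≤ : ∀ {d x c} → d ≤ x → 𝟎 < c → ωpow d ≤ ω^ x + c
ωpow-≤ (inj₁ p)    _ = inj₁ (exp< p)
ωpow-≤ (inj₂ refl) q = inj₁ (rest< q)

cmp-refl : ∀ a → cmp a a ≡ eq
cmp-refl 𝟎          = refl
cmp-refl (ω^ a + b) rewrite cmp-refl a = cmp-refl b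

cmp-< : ∀ {a b} → a < b → cmp a b ≡ lt
cmp-< 0<ω = refl
cmp-< (exp< p) rewrite cmp-< p = refl
cmp-< {ω^ a + _} (rest< p) rewrite cmp-refl a = cmp-< p

cmp-eq-sound : ∀ a b → cmp a b ≡ eq → a ≡ b
cmp-eq-sound 𝟎          𝟎          _ = refl
cmp-eq-sound 𝟎          (ω^ _ + _) ()
cmp-eq-sound (ω^ _ + _) 𝟎          ()
cmp-eq-sound (ω^ a + b) (ω^ c + d) e with cmp a c in h
... | eq = cong₂ ω^_+_ (cmp-eq-sound a c h) (cmp-eq-sound b d e)

cmp-lt-sound : ∀ a b → cmp a b ≡ lt → a < b
cmp-lt-sound 𝟎          𝟎          ()
cmp-lt-sound 𝟎          (ω^ _ + _) _ = 0<ω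
cmp-lt-sound (ω^ _ + _) 𝟎          ()
cmp-lt-sound (ω^ a + b) (ω^ c + d) e with cmp a c in h
... | lt = exp< (cmp-lt-sound a c h)
... | eq with cmp-eq-sound a c h
...   | refl = rest< (cmp-lt-sound b d e)

<ᵇ-false : ∀ {a b} → b ≤ a → (a <ᵇ b) ≡ false
<ᵇ-false {a} {b} q with cmp a b in h
... | lt = ⊥-elim (≤⇒≯ q (cmp-lt-sound a b h))
... | eq = refl
... | gt = refl

⊕-absorb : ∀ {x b d} → x < d → (ω^ x + b) ⊕ ωpow d ≡ ωpow d
⊕-absorb p rewrite cmp-< p = refl

⊕-tail : ∀ {x b d} → d ≤ x → (ω^ x + b) ⊕ ωpow d ≡ ω^ x + (b ⊕ ωpow d)
⊕-tail q rewrite <ᵇ-false q = refl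

<⊕ : ∀ a d → a < a ⊕ ωpow d
<⊕ 𝟎          d = 0<ω
<⊕ (ω^ x + b) d with <-or-≥ x d
... | inj₁ p rewrite ⊕-absorb {x} {b} p = exp< p
... | inj₂ q rewrite ⊕-tail {x} {b} q = rest< (<⊕ b d)

0<⊕ : ∀ a d → 𝟎 < a ⊕ ωpow d
0<⊕ a d = ≤-<-trans (0≤ a) (<⊕ a d)

ℓ-cons : ∀ x {c} → 𝟎 < c → ℓ (ω^ x + c) ≡ ℓ c
ℓ-cons x 0<ω = refl

ℓ-⊕ : ∀ a d → ℓ (a ⊕ ωpow d) ≡ d
ℓ-⊕ 𝟎          d = refl
ℓ-⊕ (ω^ x + b) d with <-or-≥ x d
... | inj₁ p rewrite ⊕-absorb {x} {b} p = refl
... | inj₂ q rewrite ⊕-tail {x} {b} q = trans (ℓ-cons x (0<⊕ b d)) (ℓ-⊕ b d)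

⊕-monoˡ-< : ∀ {a a'} d → a < a' → a ⊕ ωpow d ≤ a' ⊕ ωpow d
⊕-monoˡ-< {_} {ω^ x' + b'} d 0<ω with <-or-≥ x' d
... | inj₁ p rewrite ⊕-absorb {x'} {b'} p = inj₂ refl
... | inj₂ q rewrite ⊕-tail {x'} {b'} q = ωpow-≤ q (0<⊕ b' d)
⊕-monoˡ-< {ω^ x + b} {ω^ x' + b'} d (exp< p) with <-or-≥ x d | <-or-≥ x' d
... | inj₁ q | inj₁ q' rewrite ⊕-absorb {x} {b} q | ⊕-absorb {x'} {b'} q' = inj₂ refl
... | inj₁ q | inj₂ r' rewrite ⊕-absorb {x} {b} q | ⊕-tail {x'} {b'} r' = ωpow-≤ r' (0<⊕ b' d)
... | inj₂ r | inj₁ q' = ⊥-elim (≤⇒≯ r (<-trans p q'))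
... | inj₂ r | inj₂ r' rewrite ⊕-tail {x} {b} r | ⊕-tail {x'} {b'} r' = inj₁ (exp< p)
⊕-monoˡ-< {ω^ x + b} {ω^ _ + b'} d (rest< p) with <-or-≥ x d
... | inj₁ q rewrite ⊕-absorb {x} {b} q | ⊕-absorb {x} {b'} q = inj₂ refl
... | inj₂ r rewrite ⊕-tail {x} {b} r | ⊕-tail {x} {b'} r = cons-≤ (⊕-monoˡ-< d p)

⊕-monoˡ : ∀ {a a'} d → a ≤ a' → a ⊕ ωpow d ≤ a' ⊕ ωpow d
⊕-monoˡ d (inj₁ p)    = ⊕-monoˡ-< d p
⊕-monoˡ d (inj₂ refl) = inj₂ refl

⊕-monoʳ : ∀ a {d d'} → d ≤ d' → a ⊕ ωpow d ≤ a ⊕ ωpow d'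
⊕-monoʳ a          (inj₂ refl) = inj₂ refl
⊕-monoʳ 𝟎          (inj₁ p)    = inj₁ (exp< p)
⊕-monoʳ (ω^ x + b) {d} {d'} (inj₁ p) with <-or-≥ x d | <-or-≥ x d'
... | inj₁ q | inj₁ q' rewrite ⊕-absorb {x} {b} q | ⊕-absorb {x} {b} q' = inj₁ (exp< p)
... | inj₁ q | inj₂ r' = ⊥-elim (≤⇒≯ r' (<-trans q p))
... | inj₂ r | inj₁ q' rewrite ⊕-tail {x} {b} r | ⊕-absorb {x} {b} q' = inj₁ (exp< q')
... | inj₂ r | inj₂ r' rewrite ⊕-tail {x} {b} r | ⊕-tail {x} {b} r' = cons-≤ (⊕-monoʳ b (inj₁ p))

NF-ωpow : ∀ {d} → NF d → NF (ωpow d)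
NF-ωpow nd = nfω nd nf0 tt

NF-⊕ : ∀ {a d} → NF a → NF d → NF (a ⊕ ωpow d)
NF-⊕ {𝟎} nf0 nd = NF-ωpow nd
NF-⊕ {ω^ x + b} {d} (nfω nx nb lb) nd with <-or-≥ x d
... | inj₁ q rewrite ⊕-absorb {x} {b} q = NF-ωpow nd
... | inj₂ r rewrite ⊕-tail {x} {b} r = nfω nx (NF-⊕ nb nd) (leadLe-⊕ b lb r)
  where
  leadLe-⊕ : ∀ {x d} b → LeadLe b x → d ≤ x → LeadLe (b ⊕ ωpow d) x
  leadLe-⊕ 𝟎 _ r = r
  leadLe-⊕ {x} {d} (ω^ y + z) ly r with <-or-≥ y d
  ... | inj₁ q rewrite ⊕-absorb {y} {z} q = r
  ... | inj₂ r' rewrite ⊕-tail {y} {z} r' = ly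

ℓ-≤-lead : ∀ {y z} → NF (ω^ y + z) → ℓ (ω^ y + z) ≤ y
ℓ-≤-lead {z = 𝟎}         _              = inj₂ refl
ℓ-≤-lead {z = ω^ _ + _} (nfω _ nz l) = ≤-trans (ℓ-≤-lead nz) l

ωpow-ℓ-≤ : ∀ {y z} → NF (ω^ y + z) → ωpow (ℓ (ω^ y + z)) ≤ ω^ y + z
ωpow-ℓ-≤ {z = 𝟎}         _              = inj₂ refl
ωpow-ℓ-≤ {z = ω^ _ + _} (nfω _ nz l) = ωpow-≤ (≤-trans (ℓ-≤-lead nz) l) 0<ω

⊕-ℓ-≤ : ∀ {g v} → NF g → NF v → g < v → g ⊕ ωpow (ℓ v) ≤ v
⊕-ℓ-≤ {𝟎} _ nv 0<ω = ωpow-ℓ-≤ nv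
⊕-ℓ-≤ {ω^ x + b} {ω^ y + z} _ nv (exp< p) with <-or-≥ x (ℓ (ω^ y + z))
... | inj₁ q rewrite ⊕-absorb {x} {b} q = ωpow-ℓ-≤ nv
... | inj₂ r rewrite ⊕-tail {x} {b} r = inj₁ (exp< p)
⊕-ℓ-≤ {ω^ x + b} {ω^ _ + 𝟎} _ _ (rest< ())
⊕-ℓ-≤ {ω^ x + b} {ω^ _ + (ω^ y' + z')} (nfω _ nb _) (nfω _ nz lz) (rest< p)
  with <-or-≥ x (ℓ (ω^ y' + z'))
... | inj₁ q = ⊥-elim (≤⇒≯ (≤-trans (ℓ-≤-lead nz) lz) q)
... | inj₂ r rewrite ⊕-tail {x} {b} r = cons-≤ (⊕-ℓ-≤ nb nz p)

max : Tm → Tm → Tm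
max a b with <-or-≥ a b
... | inj₁ _ = b
... | inj₂ _ = a

max-≥ˡ : ∀ a b → a ≤ max a b
max-≥ˡ a b with <-or-≥ a b
... | inj₁ p = inj₁ p
... | inj₂ _ = inj₂ refl

max-≥ʳ : ∀ a b → b ≤ max a b
max-≥ʳ a b with <-or-≥ a b
... | inj₁ _ = inj₂ refl
... | inj₂ q = q

max-lub : ∀ {a b v} → a ≤ v → b ≤ v → max a b ≤ v
max-lub {a} {b} p q with <-or-≥ a b
... | inj₁ _ = q
... | inj₂ _ = p

NF-max : ∀ {a b} → NF a → NF b → NF (max a b)
NF-max {a} {b} p q with <-or-≥ a b
... | inj₁ _ = q
... | inj₂ _ = p

-- raise g d: the least normal form v ≥ g with d ≤ ℓ v, namely g if already
-- d ≤ ℓ g and g + ω^d otherwise (the recursion step of the explicit meet)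
raise : Tm → Tm → Tm
raise g d with <-or-≥ (ℓ g) d
... | inj₁ _ = g ⊕ ωpow d
... | inj₂ _ = g

raise-ℓ : ∀ g d → d ≤ ℓ (raise g d)
raise-ℓ g d with <-or-≥ (ℓ g) d
... | inj₁ _ = inj₂ (sym (ℓ-⊕ g d))
... | inj₂ q = q

raise-≥ : ∀ g d → g ≤ raise g d
raise-≥ g d with <-or-≥ (ℓ g) d
... | inj₁ _ = inj₁ (<⊕ g d)
... | inj₂ _ = inj₂ refl

NF-raise : ∀ {g d} → NF g → NF d → NF (raise g d)
NF-raise {g} {d} ng nd with <-or-≥ (ℓ g) d
... | inj₁ _ = NF-⊕ ng nd
... | inj₂ _ = ng

raise-least : ∀ {g v} d → NF g → NF v → g ≤ v → d ≤ ℓ v → raise g d ≤ v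
raise-least {g} d ng nv g≤v d≤ℓv with <-or-≥ (ℓ g) d | g≤v
... | inj₂ _  | _         = g≤v
... | inj₁ ℓg<d | inj₂ refl = ⊥-elim (≤⇒≯ d≤ℓv ℓg<d)
... | inj₁ _  | inj₁ g<v  = ≤-trans (⊕-monoʳ g d≤ℓv) (⊕-ℓ-≤ ng nv g<v)

≤ᵇ-true : ∀ {i n} → i ≤ℕ n → (i ≤ᵇ n) ≡ true
≤ᵇ-true {i} {n} p with i ≤ᵇ n | ℕₚ.≤⇒≤ᵇ p
... | true | _ = refl

≤ᵇ-false : ∀ {i n} → n <ℕ i → (i ≤ᵇ n) ≡ false
≤ᵇ-false {i} {n} p with i ≤ᵇ n in e
... | true  = ⊥-elim (ℕₚ.<⇒≱ p (ℕₚ.≤ᵇ⇒≤ i n (subst T (sym e) tt)))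
... | false = refl

VanishesAbove : ℕ → Seq → Set
VanishesAbove n s = ∀ j → n <ℕ j → s j ≡ 𝟎

trunc : ℕ → Seq → Seq
trunc n s j = if j ≤ᵇ n then s j else 𝟎

trunc-in : ∀ n s {j} → j ≤ℕ n → trunc n s j ≡ s j
trunc-in n s p rewrite ≤ᵇ-true p = refl

trunc-vanishes : ∀ n s → VanishesAbove n (trunc n s)
trunc-vanishes n s j p rewrite ≤ᵇ-false p = refl

trunc-≥𝔍 : ∀ n s → s ≤𝔍 trunc n s
trunc-≥𝔍 n s j with j ℕₚ.≤? n
... | yes p rewrite trunc-in n s p = inj₂ refl
... | no p rewrite trunc-vanishes n s j (ℕₚ.≰⇒> p) = 0≤ _

trunc-ign : ∀ n s → IsIgn s → IsIgn (trunc n s)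
trunc-ign n s is j = nf , ≤ℓ
  where
  nf : NF (trunc n s j)
  nf with j ℕₚ.≤? n
  ... | yes p rewrite trunc-in n s p = proj₁ (is j)
  ... | no p rewrite trunc-vanishes n s j (ℕₚ.≰⇒> p) = nf0
  ≤ℓ : trunc n s (suc j) ≤ ℓ (trunc n s j)
  ≤ℓ with suc j ℕₚ.≤? n
  ... | yes p rewrite trunc-in n s p | trunc-in n s (ℕₚ.≤-trans (ℕₚ.n≤1+n j) p) = proj₂ (is j)
  ... | no p rewrite trunc-vanishes n s (suc j) (ℕₚ.≰⇒> p) = 0≤ _

◇-vanishes : ∀ n s → VanishesAbove n (◇ n s)
◇-vanishes n s j p rewrite ≤ᵇ-false p = refl

◇-in : ∀ n s {j} → j ≤ℕ n → ◇ n s j ≡ dia-aux s (n ∸ j) j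
◇-in n s p rewrite ≤ᵇ-true p = refl

◇-step : ∀ n s {j} → j ≤ℕ n → ◇ n s j ≡ s j ⊕ ωpow (◇ n s (suc j))
◇-step n s {j} p with ℕₚ.m≤n⇒m<n∨m≡n p
... | inj₁ q = trans (◇-in n s p)
                 (trans (cong (λ k → dia-aux s k j) (ℕₚ.+-∸-assoc 1 q))
                        (cong (λ x → s j ⊕ ωpow x) (sym (◇-in n s q))))
... | inj₂ refl = trans (◇-in n s p)
                 (trans (cong (λ k → dia-aux s k j) (ℕₚ.n∸n≡0 j))
                        (cong (λ x → s j ⊕ ωpow x) (sym (◇-vanishes n s (suc j) (ℕₚ.n<1+n j)))))

◇-ign : ∀ n s → IsIgn s → IsIgn (◇ n s)
◇-ign n s is j = nf , ≤ℓ
  where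
  NF-dia : ∀ k j → NF (dia-aux s k j)
  NF-dia zero    j = NF-⊕ (proj₁ (is j)) nf0
  NF-dia (suc k) j = NF-⊕ (proj₁ (is j)) (NF-dia k (suc j))
  nf : NF (◇ n s j)
  nf with j ℕₚ.≤? n
  ... | yes p = subst NF (sym (◇-in n s p)) (NF-dia (n ∸ j) j)
  ... | no p = subst NF (sym (◇-vanishes n s j (ℕₚ.≰⇒> p))) nf0
  ≤ℓ : ◇ n s (suc j) ≤ ℓ (◇ n s j)
  ≤ℓ with j ℕₚ.≤? n
  ... | yes p = inj₂ (sym (trans (cong ℓ (◇-step n s p)) (ℓ-⊕ (s j) _)))
  ... | no p rewrite ◇-vanishes n s (suc j) (ℕₚ.<-trans (ℕₚ.≰⇒> p) (ℕₚ.n<1+n j)) = 0≤ _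

◇-mono : ∀ n s s' → (∀ j → j ≤ℕ n → s j ≤ s' j) → ∀ j → ◇ n s j ≤ ◇ n s' j
◇-mono n s s' s≤s' j with j ℕₚ.≤? n
... | yes p rewrite ◇-in n s p | ◇-in n s' p =
        dia-mono (n ∸ j) j (subst (_≤ℕ n) (sym (ℕₚ.m∸n+n≡m p)) ℕₚ.≤-refl)
  where
  dia-mono : ∀ k j → k + j ≤ℕ n → dia-aux s k j ≤ dia-aux s' k j
  dia-mono zero    j p = ⊕-monoˡ 𝟎 (s≤s' j p)
  dia-mono (suc k) j p =
    ≤-trans (⊕-monoˡ (dia-aux s k (suc j)) (s≤s' j (ℕₚ.≤-trans (ℕₚ.m≤n+m j (suc k)) p)))
            (⊕-monoʳ (s' j) (dia-mono k (suc j) (subst (_≤ℕ n) (sym (ℕₚ.+-suc k j)) p)))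
... | no p rewrite ◇-vanishes n s j (ℕₚ.≰⇒> p) | ◇-vanishes n s' j (ℕₚ.≰⇒> p) = inj₂ refl

-- Meets of sequences vanishing above n

-- Downward from index n: uⱼ = raise (max sⱼ s'ⱼ) u_{j+1}; the entries with
-- index > n are 0.  meetFrom j k computes uⱼ when j + k = n + 1.
module Meet (n : ℕ) (s s' : Seq) where

  meetFrom : ℕ → ℕ → Tm
  meetFrom j zero    = 𝟎
  meetFrom j (suc k) = raise (max (s j) (s' j)) (meetFrom (suc j) k)

  meet : Seq
  meet j = meetFrom j (suc n ∸ j)

  meet-step : ∀ {j} → j ≤ℕ n → meet j ≡ raise (max (s j) (s' j)) (meet (suc j))
  meet-step p rewrite ℕₚ.+-∸-assoc 1 p = refl

  meet-vanishes : VanishesAbove n meet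
  meet-vanishes j p rewrite ℕₚ.m≤n⇒m∸n≡0 p = refl

  meet-≥ : VanishesAbove n s → VanishesAbove n s' →
           ∀ j → s j ≤ meet j × s' j ≤ meet j
  meet-≥ zs zs' j with j ℕₚ.≤? n
  ... | yes p rewrite meet-step p =
          ≤-trans (max-≥ˡ (s j) (s' j)) (raise-≥ _ _) ,
          ≤-trans (max-≥ʳ (s j) (s' j)) (raise-≥ _ _)
  ... | no p rewrite zs j (ℕₚ.≰⇒> p) | zs' j (ℕₚ.≰⇒> p) = 0≤ _ , 0≤ _

  isMeet : IsIgn s → IsIgn s' → VanishesAbove n s → VanishesAbove n s' →
           IsMeet s s' meet
  isMeet is is' zs zs' = ign , proj₁ ∘ meet-≥ zs zs' , proj₂ ∘ meet-≥ zs zs' , greatest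
    where
    NF-meetFrom : ∀ k j → NF (meetFrom j k)
    NF-meetFrom zero    j = nf0
    NF-meetFrom (suc k) j =
      NF-raise (NF-max (proj₁ (is j)) (proj₁ (is' j))) (NF-meetFrom k (suc j))
    ign : IsIgn meet
    ign j = NF-meetFrom (suc n ∸ j) j , ≤ℓ
      where
      ≤ℓ : meet (suc j) ≤ ℓ (meet j)
      ≤ℓ with j ℕₚ.≤? n
      ... | yes p rewrite meet-step p = raise-ℓ (max (s j) (s' j)) (meet (suc j))
      ... | no p rewrite meet-vanishes (suc j) (ℕₚ.<-trans (ℕₚ.≰⇒> p) (ℕₚ.n<1+n j)) = 0≤ _
    greatest : ∀ v → IsIgn v → v ≤𝔍 s → v ≤𝔍 s' → v ≤𝔍 meet
    greatest v iv s≤v s'≤v j = below (suc n ∸ j) j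
      where
      below : ∀ k j → meetFrom j k ≤ v j
      below zero    j = 0≤ _
      below (suc k) j =
        raise-least _ (NF-max (proj₁ (is j)) (proj₁ (is' j))) (proj₁ (iv j))
          (max-lub (s≤v j) (s'≤v j)) (≤-trans (below k (suc j)) (proj₂ (iv j)))

filter-bound : ∀ {G} → IsFilter G → ∀ n {s s'} → G s → G s' →
  Σ Seq (λ u → G u × (∀ j → j ≤ℕ n → s j ≤ u j × s' j ≤ u j))
filter-bound {G} FG n {s} {s'} Gs Gs' =
  u , meet S S' u (upward _ _ Gs iS (trunc-≥𝔍 n s)) (upward _ _ Gs' iS' (trunc-≥𝔍 n s'))
        (Meet.isMeet n S S' iS iS' (trunc-vanishes n s) (trunc-vanishes n s')) ,
  bound
  where
  open IsFilter FG
  S S' u : Seq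
  S  = trunc n s
  S' = trunc n s'
  u  = Meet.meet n S S'
  iS  = trunc-ign n s (sub s Gs)
  iS' = trunc-ign n s' (sub s' Gs')
  bound : ∀ j → j ≤ℕ n → s j ≤ u j × s' j ≤ u j
  bound j p with Meet.meet-≥ n S S' (trunc-vanishes n s) (trunc-vanishes n s') j
  ... | S≤u , S'≤u rewrite trunc-in n s p | trunc-in n s' p = S≤u , S'≤u

-- Projections of upward closed subsets of I are downward closed

UpwardClosed : (Seq → Set) → Set
UpwardClosed P = ∀ s t → P s → IsIgn t → s ≤𝔍 t → P t

-- replaceAt w α i is the sequence w₀, …, w_{i-1}, α, 0, 0, …
replaceAt : Seq → Tm → ℕ → Seq
replaceAt w α zero    zero    = α
replaceAt w α zero    (suc j) = 𝟎
replaceAt w α (suc i) zero    = w zero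
replaceAt w α (suc i) (suc j) = replaceAt (w ∘ suc) α i j

replaceAt-at : ∀ w α i → replaceAt w α i i ≡ α
replaceAt-at w α zero    = refl
replaceAt-at w α (suc i) = replaceAt-at (w ∘ suc) α i

replaceAt-≥𝔍 : ∀ w α i → α ≤ w i → w ≤𝔍 replaceAt w α i
replaceAt-≥𝔍 w α zero    α≤ zero    = α≤
replaceAt-≥𝔍 w α zero    α≤ (suc j) = 0≤ _
replaceAt-≥𝔍 w α (suc i) α≤ zero    = inj₂ refl
replaceAt-≥𝔍 w α (suc i) α≤ (suc j) = replaceAt-≥𝔍 (w ∘ suc) α i α≤ j

replaceAt-ign : ∀ w α i → IsIgn w → NF α → α ≤ w i → IsIgn (replaceAt w α i)
replaceAt-ign w α zero    iw nα α≤ zero    = nα , 0≤ _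
replaceAt-ign w α zero    iw nα α≤ (suc j) = nf0 , inj₂ refl
replaceAt-ign w α (suc i) iw nα α≤ zero    =
  proj₁ (iw 0) , ≤-trans (replaceAt-≥𝔍 (w ∘ suc) α i α≤ 0) (proj₂ (iw 0))
replaceAt-ign w α (suc i) iw nα α≤ (suc j) = replaceAt-ign (w ∘ suc) α i (iw ∘ suc) nα α≤ j

Proj-downward : ∀ {P} → UpwardClosed P → ∀ {w} → P w → IsIgn w →
  ∀ i {α} → NF α → α ≤ w i → Proj P i α
Proj-downward up {w} Pw iw i {α} nα α≤ =
  replaceAt w α i ,
  up w _ Pw (replaceAt-ign w α i iw nα α≤) (replaceAt-≥𝔍 w α i α≤) ,
  replaceAt-at w α i

◇Filt-upward : ∀ n G → UpwardClosed (◇Filt n G)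
◇Filt-upward n G t t' (_ , s , Gs , ◇s≤t) it' t≤t' =
  it' , s , Gs , λ j → ≤-trans (t≤t' j) (◇s≤t j)

◇Filt-◇ : ∀ {G} → IsFilter G → ∀ n {s} → G s → ◇Filt n G (◇ n s)
◇Filt-◇ FG n {s} Gs = ◇-ign n s (IsFilter.sub FG s Gs) , s , Gs , λ _ → inj₂ refl

module ◇Projections {G : Seq → Set} (FG : IsFilter G) (n : ℕ) where
  open IsFilter FG

  H : Seq → Set
  H = ◇Filt n G

  -- every member of H vanishes at n+1, and H is inhabited
  top : ∀ α → Proj H (suc n) α ⇔ α ≡ 𝟎
  top α = mk⇔ to from
    where
    to : Proj H (suc n) α → α ≡ 𝟎
    to (t , (_ , s , _ , ◇s≤t) , refl)
      with subst (t (suc n) ≤_) (◇-vanishes n s (suc n) (ℕₚ.n<1+n n)) (◇s≤t (suc n))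
    ... | inj₂ tₙ₊₁≡0 = tₙ₊₁≡0
    to _ | inj₁ ()
    from : α ≡ 𝟎 → Proj H (suc n) α
    from refl with nonempty
    ... | s , Gs = Proj-downward (◇Filt-upward n G) (◇Filt-◇ FG n Gs) (◇-ign n s (sub s Gs))
                     (suc n) nf0 (0≤ _)

  Generated : ℕ → Tm → Set
  Generated i α = Σ Tm (λ γ → Σ Tm (λ δ → Proj G i γ × Proj H (suc i) δ × α ≤ γ ⊕ ωpow δ))

  level : ∀ i → i ≤ℕ n → ∀ α → NF α → Proj H i α ⇔ Generated i α
  level i i≤n α nα = mk⇔ to from
    where
    -- α ≤ (◇ₙs)ᵢ = sᵢ + ω^{(◇ₙs)_{i+1}}
    to : Proj H i α → Generated i α
    to (t , (_ , s , Gs , ◇s≤t) , refl) =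
      s i , ◇ n s (suc i) , (s , Gs , refl) , (◇ n s , ◇Filt-◇ FG n Gs , refl) ,
      subst (t i ≤_) (◇-step n s i≤n) (◇s≤t i)
    -- with u ∈ G bounding s, s' below n:  α ≤ sᵢ + ω^δ ≤ uᵢ + ω^{(◇ₙu)_{i+1}} = (◇ₙu)ᵢ
    from : Generated i α → Proj H i α
    from (_ , _ , (s , Gs , refl) , (t , (_ , s' , Gs' , ◇s'≤t) , refl) , α≤)
      with filter-bound FG n Gs Gs'
    ... | u , Gu , bound =
      Proj-downward (◇Filt-upward n G) (◇Filt-◇ FG n Gu) (◇-ign n u (sub u Gu)) i nα α≤◇u
      where
      δ≤◇u : t (suc i) ≤ ◇ n u (suc i)
      δ≤◇u = ≤-trans (◇s'≤t (suc i)) (◇-mono n s' u (λ j p → proj₂ (bound j p)) (suc i))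
      α≤◇u : α ≤ ◇ n u i
      α≤◇u = subst (α ≤_) (sym (◇-step n u i≤n))
               (≤-trans α≤ (≤-trans (⊕-monoˡ (t (suc i)) (proj₁ (bound i i≤n)))
                                    (⊕-monoʳ (u i) δ≤◇u)))

mainTheorem7 : (G : Seq → Set) → IsFilter G → (n : ℕ) →
    (∀ α → (Proj (◇Filt n G) (suc n) α ⇔ α ≡ 𝟎)) ×
    (∀ i → i ≤ℕ n → ∀ α → NF α →
      (Proj (◇Filt n G) i α ⇔
        Σ Tm (λ γ → Σ Tm (λ δ →
          Proj G i γ × Proj (◇Filt n G) (suc i) δ × α ≤ γ ⊕ ωpow δ))))
mainTheorem7 G FG n = ◇Projections.top FG n , ◇Projections.level FG n
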